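{- Let $([\![\cdot]\!],\varphi,\asymp)$ be a valid encoding from the full $\pi$-calculus into the $\pi$-calculus without match. Let $N$ be a finite set of names, $a,b$ names with $a\neq b$, and $C^{[a=b]}_{N\cup\{a,b\}}[\cdot]$ the context introduced by $[\![\cdot]\!]$ (by compositionality) to encode the match prefix $[a=b]$. Then $C^{[a=b]}_{N\cup\{a,b\}}[\cdot]$ cannot reach success on its own, i.e. there is no $T$ with $C^{[a=b]}_{N\cup\{a,b\}}[\cdot] \longrightarrow^* T$ such that $\checkmark$ is an unguarded subterm of $T$.
   Context: Source language: full $\pi$-calculus with free choice, match prefix $[a=b]P$ and success $\checkmark$; target: same without match; standard reduction semantics $\longrightarrow$, $\longrightarrow^*$ its reflexive–transitive closure. A term reaches success if it reduces to a term with $\checkmark$ unguarded (not under a prefix or unsatisfied match). Valid encoding means Gorla's criteria: compositionality (each operator translated by a fixed context parametrised on the free names of the source term), name invariance with respect to the renaming policy $\varphi$ (mapping names to disjoint name vectors of fixed length), operational completeness and soundness up to a success-respecting reduction bisimulation $\asymp$, divergence reflection, and success sensitiveness ($S$ reaches success iff $[\![S]\!]$ does). Unguarded subterms of contexts treat the hole as $\{[\cdot]\}$. -}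

module Defs where

open import Data.Nat using (ℕ; zero; suc)
open import Data.Bool using (Bool; true; false; T)
open import Data.Empty using (⊥)
open import Data.Fin using (Fin) renaming (zero to fz; suc to fs)
open import Data.Vec using (Vec; []; _∷_; lookup; map)
open import Data.List using (List)
open import Data.List.Membership.Propositional using (_∈_)
open import Data.Product using (Σ; _×_; _,_; ∃)
open import Relation.Binary.PropositionalEquality using (_≡_; _≢_)
open import Relation.Nullary using (¬_)
open import Function using (_∘_; _⇔_)
open import Function.Definitions using (Injective)

-- Names are natural numbers used as de Bruijn indices: bound
-- names are referred to by position (index 0 = innermost binder), free
-- names are the indices that escape all binders.  Thus α-equivalence
-- is syntactic equality _≡_.

Name : Set
Name = ℕ

-- One syntax parametrised by
--   m : Bool  -- whether the match prefix is available (true = source)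
--   H : Set   -- the set of hole labels (⊥ = a proper process, Fin n = a
--                context with n holes)
-- A hole  hole h σ  is the hole number h under a pending name renaming σ
-- (the standard de Bruijn treatment of context holes: renamings of a
-- context are recorded at its holes and applied when the hole is
-- filled).  A hole is an inert subterm: it has no reductions and is not
-- success.

data Proc (m : Bool) (H : Set) : Set where
  𝟘     : Proc m H
  ✓     : Proc m H
  _∣_   : Proc m H → Proc m H → Proc m H
  _⊕_   : Proc m H → Proc m H → Proc m H
  ν     : Proc m H → Proc m H                      -- restriction, binds 0
  !_    : Proc m H → Proc m H
  inp   : Name → Proc m H → Proc m H               -- a(x).P, x = index 0 in P
  out   : Name → Name → Proc m H → Proc m H
  τ∙_   : Proc m H → Proc m H
  match : T m → Name → Name → Proc m H → Proc m H
  hole  : H → (Name → Name) → Proc m H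

infixl 6 _∣_
infixl 7 _⊕_

SProc : Set
SProc = Proc true ⊥

TProc : Set
TProc = Proc false ⊥

TCtx : ℕ → Set
TCtx n = Proc false (Fin n)

ext : (Name → Name) → Name → Name
ext ρ zero    = zero
ext ρ (suc n) = suc (ρ n)

rename : ∀ {m H} → (Name → Name) → Proc m H → Proc m H
rename ρ 𝟘             = 𝟘
rename ρ ✓             = ✓
rename ρ (P ∣ Q)       = rename ρ P ∣ rename ρ Q
rename ρ (P ⊕ Q)       = rename ρ P ⊕ rename ρ Q
rename ρ (ν P)         = ν (rename (ext ρ) P)
rename ρ (! P)         = ! rename ρ P
rename ρ (inp a P)     = inp (ρ a) (rename (ext ρ) P)
rename ρ (out a b P)   = out (ρ a) (ρ b) (rename ρ P)
rename ρ (τ∙ P)        = τ∙ rename ρ P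
rename ρ (match t a b P) = match t (ρ a) (ρ b) (rename ρ P)
rename ρ (hole h σ)    = hole h (ρ ∘ σ)

-- [b/0] for the body of an input:  0 ↦ b,  suc n ↦ n
subst0 : Name → Name → Name
subst0 b zero    = b
subst0 b (suc n) = n

swap01 : Name → Name
swap01 zero          = suc zero
swap01 (suc zero)    = zero
swap01 (suc (suc n)) = suc (suc n)

fill : ∀ {m H} → Proc m H → (H → Proc m ⊥) → Proc m ⊥
fill 𝟘 f               = 𝟘
fill ✓ f               = ✓
fill (P ∣ Q) f         = fill P f ∣ fill Q f
fill (P ⊕ Q) f         = fill P f ⊕ fill Q f
fill (ν P) f           = ν (fill P f)
fill (! P) f           = ! fill P f
fill (inp a P) f       = inp a (fill P f)
fill (out a b P) f     = out a b (fill P f)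
fill (τ∙ P) f          = τ∙ fill P f
fill (match t a b P) f = match t a b (fill P f)
fill (hole h σ) f      = rename σ (f h)

data FreeIn {m H} : Name → Proc m H → Set where
  parL   : ∀ {x P Q} → FreeIn x P → FreeIn x (P ∣ Q)
  parR   : ∀ {x P Q} → FreeIn x Q → FreeIn x (P ∣ Q)
  sumL   : ∀ {x P Q} → FreeIn x P → FreeIn x (P ⊕ Q)
  sumR   : ∀ {x P Q} → FreeIn x Q → FreeIn x (P ⊕ Q)
  res    : ∀ {x P} → FreeIn (suc x) P → FreeIn x (ν P)
  rep    : ∀ {x P} → FreeIn x P → FreeIn x (! P)
  inpSub : ∀ {a P} → FreeIn a (inp a P)
  inpBody : ∀ {x a P} → FreeIn (suc x) P → FreeIn x (inp a P)
  outSub : ∀ {a b P} → FreeIn a (out a b P)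
  outObj : ∀ {a b P} → FreeIn b (out a b P)
  outBody : ∀ {x a b P} → FreeIn x P → FreeIn x (out a b P)
  tau    : ∀ {x P} → FreeIn x P → FreeIn x (τ∙ P)
  matchL : ∀ {t a b P} → FreeIn a (match t a b P)
  matchR : ∀ {t a b P} → FreeIn b (match t a b P)
  matchBody : ∀ {x t a b P} → FreeIn x P → FreeIn x (match t a b P)

infix 4 _≡ₛ_
data _≡ₛ_ {m H} : Proc m H → Proc m H → Set where
  refl  : ∀ {P} → P ≡ₛ P
  sym   : ∀ {P Q} → P ≡ₛ Q → Q ≡ₛ P
  trans : ∀ {P Q R} → P ≡ₛ Q → Q ≡ₛ R → P ≡ₛ R
  c-par   : ∀ {P P' Q Q'} → P ≡ₛ P' → Q ≡ₛ Q' → P ∣ Q ≡ₛ P' ∣ Q'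
  c-sum   : ∀ {P P' Q Q'} → P ≡ₛ P' → Q ≡ₛ Q' → P ⊕ Q ≡ₛ P' ⊕ Q'
  c-res   : ∀ {P P'} → P ≡ₛ P' → ν P ≡ₛ ν P'
  c-rep   : ∀ {P P'} → P ≡ₛ P' → ! P ≡ₛ ! P'
  c-inp   : ∀ {a P P'} → P ≡ₛ P' → inp a P ≡ₛ inp a P'
  c-out   : ∀ {a b P P'} → P ≡ₛ P' → out a b P ≡ₛ out a b P'
  c-tau   : ∀ {P P'} → P ≡ₛ P' → τ∙ P ≡ₛ τ∙ P'
  c-match : ∀ {t a b P P'} → P ≡ₛ P' → match t a b P ≡ₛ match t a b P'
  par-unit  : ∀ {P} → P ∣ 𝟘 ≡ₛ P
  par-comm  : ∀ {P Q} → P ∣ Q ≡ₛ Q ∣ P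
  par-assoc : ∀ {P Q R} → (P ∣ Q) ∣ R ≡ₛ P ∣ (Q ∣ R)
  sum-unit  : ∀ {P} → P ⊕ 𝟘 ≡ₛ P
  sum-comm  : ∀ {P Q} → P ⊕ Q ≡ₛ Q ⊕ P
  sum-assoc : ∀ {P Q R} → (P ⊕ Q) ⊕ R ≡ₛ P ⊕ (Q ⊕ R)
  res-nil   : ν 𝟘 ≡ₛ 𝟘
  res-swap  : ∀ {P} → ν (ν P) ≡ₛ ν (ν (rename swap01 P))
  res-extr  : ∀ {P Q} → ν P ∣ Q ≡ₛ ν (P ∣ rename suc Q)
  rep-unf   : ∀ {P} → ! P ≡ₛ P ∣ ! P
  match-eq  : ∀ {t a P} → match t a a P ≡ₛ P

infix 4 _⟶_ _⟶*_
data _⟶_ {m H} : Proc m H → Proc m H → Set where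
  com    : ∀ {M N a b P Q} →
           (M ⊕ out a b P) ∣ (inp a Q ⊕ N) ⟶ P ∣ rename (subst0 b) Q
  tau    : ∀ {M P} → (τ∙ P) ⊕ M ⟶ P
  r-par  : ∀ {P P' Q} → P ⟶ P' → P ∣ Q ⟶ P' ∣ Q
  r-res  : ∀ {P P'} → P ⟶ P' → ν P ⟶ ν P'
  r-struct : ∀ {P P' Q Q'} → P ≡ₛ P' → P' ⟶ Q' → Q' ≡ₛ Q → P ⟶ Q

data _⟶*_ {m H} : Proc m H → Proc m H → Set where
  done : ∀ {P} → P ⟶* P
  step : ∀ {P Q R} → P ⟶ Q → Q ⟶* R → P ⟶* R

data Succ {m H} : Proc m H → Set where
  here   : Succ ✓
  parL   : ∀ {P Q} → Succ P → Succ (P ∣ Q)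
  parR   : ∀ {P Q} → Succ Q → Succ (P ∣ Q)
  sumL   : ∀ {P Q} → Succ P → Succ (P ⊕ Q)
  sumR   : ∀ {P Q} → Succ Q → Succ (P ⊕ Q)
  res    : ∀ {P} → Succ P → Succ (ν P)
  rep    : ∀ {P} → Succ P → Succ (! P)
  match  : ∀ {t a P} → Succ P → Succ (match t a a P)

ReachesSucc : ∀ {m H} → Proc m H → Set
ReachesSucc P = Σ _ λ P' → (P ⟶* P') × Succ P'

Diverges : ∀ {m H} → Proc m H → Set
Diverges {m} {H} P = Σ (ℕ → Proc m H) λ f → (f 0 ≡ P) × (∀ n → f n ⟶ f (suc n))

record SuccRespRedBisim (R : TProc → TProc → Set) : Set where
  field
    simL : ∀ {P Q P'} → R P Q → P ⟶ P' → Σ _ λ Q' → (Q ⟶* Q') × R P' Q'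
    simR : ∀ {P Q Q'} → R P Q → Q ⟶ Q' → Σ _ λ P' → (P ⟶* P') × R P' Q'
    succResp : ∀ {P Q} → R P Q → ReachesSucc P ⇔ ReachesSucc Q

data Op : Set where
  nilO succO parO sumO resO repO tauO : Op
  inpO   : Name → Op
  outO   : Name → Name → Op
  matchO : Name → Name → Op

arity : Op → ℕ
arity nilO       = 0
arity succO      = 0
arity parO       = 2
arity sumO       = 2
arity resO       = 1
arity repO       = 1
arity tauO       = 1
arity (inpO a)   = 1
arity (outO a b) = 1
arity (matchO a b) = 1

apply : (o : Op) → Vec SProc (arity o) → SProc
apply nilO         []            = 𝟘
apply succO        []            = ✓
apply parO         (P ∷ Q ∷ []) = P ∣ Q
apply sumO         (P ∷ Q ∷ []) = P ⊕ Q
apply resO         (P ∷ [])     = ν P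
apply repO         (P ∷ [])     = ! P
apply tauO         (P ∷ [])     = τ∙ P
apply (inpO a)     (P ∷ [])     = inp a P
apply (outO a b)   (P ∷ [])     = out a b P
apply (matchO a b) (P ∷ [])     = match _ a b P

-- Valid encodings in the sense of Gorla.
--   enc : the translation ⟦·⟧
--   φ   : the renaming policy (names ↦ name vectors of fixed length k)
--   ≍   : the success-respecting reduction bisimulation on target terms
--   ctx : the contexts C^op_N provided by compositionality
--         (N, a finite set of names, given as a list)

record ValidEncoding (enc : SProc → TProc) (k : ℕ) (φ : Name → Vec Name k)
                     (_≍_ : TProc → TProc → Set)
                     (ctx : (o : Op) → List Name → TCtx (arity o)) : Set where
  field
    policy-disjoint : ∀ a b → a ≢ b → ∀ i j → lookup (φ a) i ≢ lookup (φ b) j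
    compositional : ∀ (o : Op) (N : List Name) (ss : Vec SProc (arity o)) →
                    (∀ x → FreeIn x (apply o ss) ⇔ x ∈ N) →
                    enc (apply o ss) ≡ fill (ctx o N) (λ i → enc (lookup ss i))
    name-invariant : ∀ (σ : Name → Name) → Σ (Name → Name) λ σ' →
                     (∀ a → φ (σ a) ≡ map σ' (φ a)) ×
                     (∀ S → (Injective _≡_ _≡_ σ → enc (rename σ S) ≡ rename σ' (enc S))
                          × (¬ Injective _≡_ _≡_ σ → enc (rename σ S) ≍ rename σ' (enc S)))
    bisim : SuccRespRedBisim _≍_
    complete : ∀ {S S'} → S ⟶* S' → Σ _ λ T → (enc S ⟶* T) × (T ≍ enc S')
    sound : ∀ {S T} → enc S ⟶* T →
            Σ _ λ S' → (S ⟶* S') × Σ _ λ T' → (T ⟶* T') × (T' ≍ enc S')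
    div-reflect : ∀ S → Diverges (enc S) → Diverges S
    succ-sens : ∀ S → ReachesSucc S ⇔ ReachesSucc (enc S)

module Submission where

-- A context that reaches success on its own makes every term
-- built from it reach success, whatever is put in its holes: filling the
-- holes commutes with structural congruence, reduction and unguarded
-- success.  By compositionality ⟦[a=b]P⟧ is C^{[a=b]}_{N∪{a,b}}[⟦P⟧]
-- whenever [a=b]P has free names N ∪ {a,b}, so by success sensitiveness
-- [a=b]P itself would reach success.  Taking for P the parallel
-- composition of the outputs ȳ⟨y⟩, y ∈ N, gives [a=b]P the required free
-- names and no syntactic occurrence of ✓ at all; since reduction never
-- creates ✓, it cannot reach success.

open import Defs
open import Data.Nat using (ℕ; zero; suc)
open import Data.Vec using (Vec; []; _∷_; lookup)
open import Data.List using (List; _∷_; [])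
open import Data.List.Membership.Propositional using (_∈_)
open import Data.List.Relation.Unary.Any using (here; there)
open import Data.Product using (Σ; _×_; _,_)
open import Data.Sum using (inj₁; inj₂)
open import Data.Bool using (Bool; true; false; _∨_; T)
open import Data.Bool.Properties using (T-∨; ∨-identityʳ; ∨-comm; ∨-assoc; ∨-idem)
open import Data.Empty using (⊥)
open import Relation.Binary.PropositionalEquality as Eq
  using (_≡_; _≢_; cong; cong₂; subst)
open import Relation.Nullary using (¬_)
open import Function using (_∘_; _⇔_; mk⇔; Equivalence)

mentionsSucc : ∀ {m H} → Proc m H → Bool
mentionsSucc 𝟘               = false
mentionsSucc ✓               = true
mentionsSucc (P ∣ Q)         = mentionsSucc P ∨ mentionsSucc Q
mentionsSucc (P ⊕ Q)         = mentionsSucc P ∨ mentionsSucc Q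
mentionsSucc (ν P)           = mentionsSucc P
mentionsSucc (! P)           = mentionsSucc P
mentionsSucc (inp a P)       = mentionsSucc P
mentionsSucc (out a b P)     = mentionsSucc P
mentionsSucc (τ∙ P)          = mentionsSucc P
mentionsSucc (match t a b P) = mentionsSucc P
mentionsSucc (hole h σ)      = false

private
  ∨-introˡ : ∀ {x y} → T x → T (x ∨ y)
  ∨-introˡ = Equivalence.from T-∨ ∘ inj₁

  ∨-introʳ : ∀ {x y} → T y → T (x ∨ y)
  ∨-introʳ = Equivalence.from T-∨ ∘ inj₂

mentionsSucc-rename : ∀ {m H} (ρ : Name → Name) (P : Proc m H) →
                      mentionsSucc (rename ρ P) ≡ mentionsSucc P
mentionsSucc-rename ρ 𝟘               = Eq.refl
mentionsSucc-rename ρ ✓               = Eq.refl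
mentionsSucc-rename ρ (P ∣ Q)         = cong₂ _∨_ (mentionsSucc-rename ρ P) (mentionsSucc-rename ρ Q)
mentionsSucc-rename ρ (P ⊕ Q)         = cong₂ _∨_ (mentionsSucc-rename ρ P) (mentionsSucc-rename ρ Q)
mentionsSucc-rename ρ (ν P)           = mentionsSucc-rename (ext ρ) P
mentionsSucc-rename ρ (! P)           = mentionsSucc-rename ρ P
mentionsSucc-rename ρ (inp a P)       = mentionsSucc-rename (ext ρ) P
mentionsSucc-rename ρ (out a b P)     = mentionsSucc-rename ρ P
mentionsSucc-rename ρ (τ∙ P)          = mentionsSucc-rename ρ P
mentionsSucc-rename ρ (match t a b P) = mentionsSucc-rename ρ P
mentionsSucc-rename ρ (hole h σ)      = Eq.refl

mentionsSucc-≡ₛ : ∀ {m H} {P Q : Proc m H} → P ≡ₛ Q → mentionsSucc P ≡ mentionsSucc Q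
mentionsSucc-≡ₛ refl          = Eq.refl
mentionsSucc-≡ₛ (sym e)       = Eq.sym (mentionsSucc-≡ₛ e)
mentionsSucc-≡ₛ (trans e e')  = Eq.trans (mentionsSucc-≡ₛ e) (mentionsSucc-≡ₛ e')
mentionsSucc-≡ₛ (c-par e e')  = cong₂ _∨_ (mentionsSucc-≡ₛ e) (mentionsSucc-≡ₛ e')
mentionsSucc-≡ₛ (c-sum e e')  = cong₂ _∨_ (mentionsSucc-≡ₛ e) (mentionsSucc-≡ₛ e')
mentionsSucc-≡ₛ (c-res e)     = mentionsSucc-≡ₛ e
mentionsSucc-≡ₛ (c-rep e)     = mentionsSucc-≡ₛ e
mentionsSucc-≡ₛ (c-inp e)     = mentionsSucc-≡ₛ e
mentionsSucc-≡ₛ (c-out e)     = mentionsSucc-≡ₛ e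
mentionsSucc-≡ₛ (c-tau e)     = mentionsSucc-≡ₛ e
mentionsSucc-≡ₛ (c-match e)   = mentionsSucc-≡ₛ e
mentionsSucc-≡ₛ (par-unit {P})            = ∨-identityʳ (mentionsSucc P)
mentionsSucc-≡ₛ (par-comm {P} {Q})        = ∨-comm (mentionsSucc P) (mentionsSucc Q)
mentionsSucc-≡ₛ (par-assoc {P} {Q} {R})   = ∨-assoc (mentionsSucc P) (mentionsSucc Q) (mentionsSucc R)
mentionsSucc-≡ₛ (sum-unit {P})            = ∨-identityʳ (mentionsSucc P)
mentionsSucc-≡ₛ (sum-comm {P} {Q})        = ∨-comm (mentionsSucc P) (mentionsSucc Q)
mentionsSucc-≡ₛ (sum-assoc {P} {Q} {R})   = ∨-assoc (mentionsSucc P) (mentionsSucc Q) (mentionsSucc R)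
mentionsSucc-≡ₛ res-nil                   = Eq.refl
mentionsSucc-≡ₛ (res-swap {P})            = Eq.sym (mentionsSucc-rename swap01 P)
mentionsSucc-≡ₛ (res-extr {P} {Q})        = cong (mentionsSucc P ∨_) (Eq.sym (mentionsSucc-rename suc Q))
mentionsSucc-≡ₛ (rep-unf {P})             = Eq.sym (∨-idem (mentionsSucc P))
mentionsSucc-≡ₛ match-eq                  = Eq.refl

mentionsSucc-⟶ : ∀ {m H} {P Q : Proc m H} → P ⟶ Q → T (mentionsSucc Q) → T (mentionsSucc P)
mentionsSucc-⟶ (com {M} {N} {_} {b} {P} {Q}) t with Equivalence.to T-∨ t
... | inj₁ tP = ∨-introˡ {mentionsSucc M ∨ mentionsSucc P} (∨-introʳ {mentionsSucc M} tP)
... | inj₂ tQ = ∨-introʳ {mentionsSucc M ∨ mentionsSucc P}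
                  (∨-introˡ {y = mentionsSucc N} (subst T (mentionsSucc-rename (subst0 b) Q) tQ))
mentionsSucc-⟶ tau t = ∨-introˡ t
mentionsSucc-⟶ (r-par r) t with Equivalence.to T-∨ t
... | inj₁ tP' = ∨-introˡ (mentionsSucc-⟶ r tP')
... | inj₂ tQ  = ∨-introʳ tQ
mentionsSucc-⟶ (r-res r) t = mentionsSucc-⟶ r t
mentionsSucc-⟶ (r-struct e r e') t =
  subst T (Eq.sym (mentionsSucc-≡ₛ e)) (mentionsSucc-⟶ r (subst T (Eq.sym (mentionsSucc-≡ₛ e')) t))

mentionsSucc-⟶* : ∀ {m H} {P Q : Proc m H} → P ⟶* Q → T (mentionsSucc Q) → T (mentionsSucc P)
mentionsSucc-⟶* done        t = t
mentionsSucc-⟶* (step r rs) t = mentionsSucc-⟶ r (mentionsSucc-⟶* rs t)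

Succ⇒mentionsSucc : ∀ {m H} {P : Proc m H} → Succ P → T (mentionsSucc P)
Succ⇒mentionsSucc here     = _
Succ⇒mentionsSucc (parL s) = ∨-introˡ (Succ⇒mentionsSucc s)
Succ⇒mentionsSucc (parR s) = ∨-introʳ (Succ⇒mentionsSucc s)
Succ⇒mentionsSucc (sumL s) = ∨-introˡ (Succ⇒mentionsSucc s)
Succ⇒mentionsSucc (sumR s) = ∨-introʳ (Succ⇒mentionsSucc s)
Succ⇒mentionsSucc (res s)  = Succ⇒mentionsSucc s
Succ⇒mentionsSucc (rep s)  = Succ⇒mentionsSucc s
Succ⇒mentionsSucc (match s) = Succ⇒mentionsSucc s

reachesSucc⇒mentionsSucc : ∀ {m H} {P : Proc m H} → ReachesSucc P → T (mentionsSucc P)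
reachesSucc⇒mentionsSucc (_ , P⟶*P' , s) = mentionsSucc-⟶* P⟶*P' (Succ⇒mentionsSucc s)

-- (2) Renaming algebra on hole-free processes
-- (on contexts the renaming functions pending at holes would have to be
-- compared extensionally, so these laws are stated for hole-free terms)

ext-cong : ∀ {ρ ρ' : Name → Name} → (∀ x → ρ x ≡ ρ' x) → ∀ x → ext ρ x ≡ ext ρ' x
ext-cong ρ≗ρ' zero    = Eq.refl
ext-cong ρ≗ρ' (suc x) = cong suc (ρ≗ρ' x)

rename-cong : ∀ {m} {ρ ρ' : Name → Name} → (∀ x → ρ x ≡ ρ' x) →
              (P : Proc m ⊥) → rename ρ P ≡ rename ρ' P
rename-cong ρ≗ρ' 𝟘               = Eq.refl
rename-cong ρ≗ρ' ✓               = Eq.refl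
rename-cong ρ≗ρ' (P ∣ Q)         = cong₂ _∣_ (rename-cong ρ≗ρ' P) (rename-cong ρ≗ρ' Q)
rename-cong ρ≗ρ' (P ⊕ Q)         = cong₂ _⊕_ (rename-cong ρ≗ρ' P) (rename-cong ρ≗ρ' Q)
rename-cong ρ≗ρ' (ν P)           = cong ν (rename-cong (ext-cong ρ≗ρ') P)
rename-cong ρ≗ρ' (! P)           = cong !_ (rename-cong ρ≗ρ' P)
rename-cong ρ≗ρ' (inp a P)       = cong₂ inp (ρ≗ρ' a) (rename-cong (ext-cong ρ≗ρ') P)
rename-cong ρ≗ρ' (out a b P)
  rewrite ρ≗ρ' a | ρ≗ρ' b        = cong (out _ _) (rename-cong ρ≗ρ' P)
rename-cong ρ≗ρ' (τ∙ P)          = cong τ∙_ (rename-cong ρ≗ρ' P)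
rename-cong ρ≗ρ' (match t a b P)
  rewrite ρ≗ρ' a | ρ≗ρ' b        = cong (match t _ _) (rename-cong ρ≗ρ' P)

ext-∘ : ∀ (ρ σ : Name → Name) x → ext ρ (ext σ x) ≡ ext (ρ ∘ σ) x
ext-∘ ρ σ zero    = Eq.refl
ext-∘ ρ σ (suc x) = Eq.refl

rename-∘ : ∀ {m} (ρ σ : Name → Name) (P : Proc m ⊥) →
           rename ρ (rename σ P) ≡ rename (ρ ∘ σ) P
rename-∘-under-binder : ∀ {m} (ρ σ : Name → Name) (P : Proc m ⊥) →
                        rename (ext ρ) (rename (ext σ) P) ≡ rename (ext (ρ ∘ σ)) P

rename-∘ ρ σ 𝟘               = Eq.refl
rename-∘ ρ σ ✓               = Eq.refl
rename-∘ ρ σ (P ∣ Q)         = cong₂ _∣_ (rename-∘ ρ σ P) (rename-∘ ρ σ Q)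
rename-∘ ρ σ (P ⊕ Q)         = cong₂ _⊕_ (rename-∘ ρ σ P) (rename-∘ ρ σ Q)
rename-∘ ρ σ (ν P)           = cong ν (rename-∘-under-binder ρ σ P)
rename-∘ ρ σ (! P)           = cong !_ (rename-∘ ρ σ P)
rename-∘ ρ σ (inp a P)       = cong (inp _) (rename-∘-under-binder ρ σ P)
rename-∘ ρ σ (out a b P)     = cong (out _ _) (rename-∘ ρ σ P)
rename-∘ ρ σ (τ∙ P)          = cong τ∙_ (rename-∘ ρ σ P)
rename-∘ ρ σ (match t a b P) = cong (match t _ _) (rename-∘ ρ σ P)

rename-∘-under-binder ρ σ P =
  Eq.trans (rename-∘ (ext ρ) (ext σ) P) (rename-cong (ext-∘ ρ σ) P)

-- Renaming a context and then filling it is renaming the filled term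
-- (the renaming is recorded at each hole and applied to its filler).
fill-rename : ∀ {m H} (ρ : Name → Name) (C : Proc m H) (f : H → Proc m ⊥) →
              fill (rename ρ C) f ≡ rename ρ (fill C f)
fill-rename ρ 𝟘               f = Eq.refl
fill-rename ρ ✓               f = Eq.refl
fill-rename ρ (P ∣ Q)         f = cong₂ _∣_ (fill-rename ρ P f) (fill-rename ρ Q f)
fill-rename ρ (P ⊕ Q)         f = cong₂ _⊕_ (fill-rename ρ P f) (fill-rename ρ Q f)
fill-rename ρ (ν P)           f = cong ν (fill-rename (ext ρ) P f)
fill-rename ρ (! P)           f = cong !_ (fill-rename ρ P f)
fill-rename ρ (inp a P)       f = cong (inp _) (fill-rename (ext ρ) P f)
fill-rename ρ (out a b P)     f = cong (out _ _) (fill-rename ρ P f)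
fill-rename ρ (τ∙ P)          f = cong τ∙_ (fill-rename ρ P f)
fill-rename ρ (match t a b P) f = cong (match t _ _) (fill-rename ρ P f)
fill-rename ρ (hole h σ)      f = Eq.sym (rename-∘ ρ σ (f h))

≡⇒≡ₛ : ∀ {m H} {P Q : Proc m H} → P ≡ Q → P ≡ₛ Q
≡⇒≡ₛ Eq.refl = refl

-- Filling preserves structural congruence; the only non-literal cases are
-- the axioms that rename a subterm, handled by fill-rename.
fill-≡ₛ : ∀ {m H} {C D : Proc m H} (f : H → Proc m ⊥) → C ≡ₛ D → fill C f ≡ₛ fill D f
fill-≡ₛ f refl         = refl
fill-≡ₛ f (sym e)      = sym (fill-≡ₛ f e)
fill-≡ₛ f (trans e e') = trans (fill-≡ₛ f e) (fill-≡ₛ f e')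
fill-≡ₛ f (c-par e e') = c-par (fill-≡ₛ f e) (fill-≡ₛ f e')
fill-≡ₛ f (c-sum e e') = c-sum (fill-≡ₛ f e) (fill-≡ₛ f e')
fill-≡ₛ f (c-res e)    = c-res (fill-≡ₛ f e)
fill-≡ₛ f (c-rep e)    = c-rep (fill-≡ₛ f e)
fill-≡ₛ f (c-inp e)    = c-inp (fill-≡ₛ f e)
fill-≡ₛ f (c-out e)    = c-out (fill-≡ₛ f e)
fill-≡ₛ f (c-tau e)    = c-tau (fill-≡ₛ f e)
fill-≡ₛ f (c-match e)  = c-match (fill-≡ₛ f e)
fill-≡ₛ f par-unit     = par-unit
fill-≡ₛ f par-comm     = par-comm
fill-≡ₛ f par-assoc    = par-assoc
fill-≡ₛ f sum-unit     = sum-unit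
fill-≡ₛ f sum-comm     = sum-comm
fill-≡ₛ f sum-assoc    = sum-assoc
fill-≡ₛ f res-nil      = res-nil
fill-≡ₛ f (res-swap {P}) =
  trans res-swap (c-res (c-res (≡⇒≡ₛ (Eq.sym (fill-rename swap01 P f)))))
fill-≡ₛ f (res-extr {P} {Q}) =
  trans res-extr (c-res (c-par refl (≡⇒≡ₛ (Eq.sym (fill-rename suc Q f)))))
fill-≡ₛ f rep-unf      = rep-unf
fill-≡ₛ f match-eq     = match-eq

fill-⟶ : ∀ {m H} {C D : Proc m H} (f : H → Proc m ⊥) → C ⟶ D → fill C f ⟶ fill D f
fill-⟶ f (com {b = b} {Q = Q}) =
  r-struct refl com (c-par refl (≡⇒≡ₛ (Eq.sym (fill-rename (subst0 b) Q f))))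
fill-⟶ f tau                 = tau
fill-⟶ f (r-par r)           = r-par (fill-⟶ f r)
fill-⟶ f (r-res r)           = r-res (fill-⟶ f r)
fill-⟶ f (r-struct e r e')   = r-struct (fill-≡ₛ f e) (fill-⟶ f r) (fill-≡ₛ f e')

fill-⟶* : ∀ {m H} {C D : Proc m H} (f : H → Proc m ⊥) → C ⟶* D → fill C f ⟶* fill D f
fill-⟶* f done        = done
fill-⟶* f (step r rs) = step (fill-⟶ f r) (fill-⟶* f rs)

fill-Succ : ∀ {m H} {C : Proc m H} (f : H → Proc m ⊥) → Succ C → Succ (fill C f)
fill-Succ f here      = here
fill-Succ f (parL s)  = parL (fill-Succ f s)
fill-Succ f (parR s)  = parR (fill-Succ f s)
fill-Succ f (sumL s)  = sumL (fill-Succ f s)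
fill-Succ f (sumR s)  = sumR (fill-Succ f s)
fill-Succ f (res s)   = res (fill-Succ f s)
fill-Succ f (rep s)   = rep (fill-Succ f s)
fill-Succ f (match s) = match (fill-Succ f s)

fill-reachesSucc : ∀ {m H} {C : Proc m H} (f : H → Proc m ⊥) →
                   ReachesSucc C → ReachesSucc (fill C f)
fill-reachesSucc f (D , C⟶*D , s) = fill D f , fill-⟶* f C⟶*D , fill-Succ f s

-- If the context C^o_N of a valid encoding reaches success on its own, so
-- does every source term o(S₁,…,Sₙ) with free names N: by
-- compositionality its encoding is a filling of C^o_N, and success
-- sensitiveness reflects success back to the source.
contextSucc⇒sourceSucc :
  ∀ {enc k φ _≍_ ctx} → ValidEncoding enc k φ _≍_ ctx →
  (o : Op) (N : List Name) (ss : Vec SProc (arity o)) →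
  (∀ x → FreeIn x (apply o ss) ⇔ x ∈ N) →
  ReachesSucc (ctx o N) → ReachesSucc (apply o ss)
contextSucc⇒sourceSucc {enc} V o N ss freeNames C-succ =
  Equivalence.from (succ-sens (apply o ss))
    (subst ReachesSucc (Eq.sym (compositional o N ss freeNames))
           (fill-reachesSucc (enc ∘ lookup ss) C-succ))
  where open ValidEncoding V

outputs : List Name → SProc
outputs []       = 𝟘
outputs (y ∷ ys) = out y y 𝟘 ∣ outputs ys

outputs-freeNames : ∀ ys x → FreeIn x (outputs ys) ⇔ x ∈ ys
outputs-freeNames ys x = mk⇔ (to ys) (from ys)
  where
  to : ∀ ys → FreeIn x (outputs ys) → x ∈ ys
  to (y ∷ ys) (parL outSub)       = here Eq.refl
  to (y ∷ ys) (parL outObj)       = here Eq.refl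
  to (y ∷ ys) (parL (outBody ()))
  to (y ∷ ys) (parR x∈)           = there (to ys x∈)

  from : ∀ ys → x ∈ ys → FreeIn x (outputs ys)
  from (y ∷ ys) (here Eq.refl) = parL outSub
  from (y ∷ ys) (there x∈)     = parR (from ys x∈)

outputs-silent : ∀ ys → ¬ T (mentionsSucc (outputs ys))
outputs-silent []       ()
outputs-silent (y ∷ ys) = outputs-silent ys

guardedOutputs-freeNames : ∀ a b N x →
  FreeIn x (match _ a b (outputs N)) ⇔ x ∈ (a ∷ b ∷ N)
guardedOutputs-freeNames a b N x = mk⇔ to from
  where
  to : FreeIn x (match _ a b (outputs N)) → x ∈ (a ∷ b ∷ N)
  to matchL          = here Eq.refl
  to matchR          = there (here Eq.refl)
  to (matchBody x∈)  = there (there (Equivalence.to (outputs-freeNames N x) x∈))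

  from : x ∈ (a ∷ b ∷ N) → FreeIn x (match _ a b (outputs N))
  from (here Eq.refl)         = matchL
  from (there (here Eq.refl)) = matchR
  from (there (there x∈))     = matchBody (Equivalence.from (outputs-freeNames N x) x∈)

-- Otherwise the source term [a=b](outputs N), whose free names
-- are {a, b} ∪ N, would reach success, yet ✓ does not even occur in it.
-- (The argument does not need a ≢ b.)
lemma7 : (enc : SProc → TProc) (k : ℕ) (φ : Name → Vec Name k)
         (_≍_ : TProc → TProc → Set)
         (ctx : (o : Op) → List Name → TCtx (arity o)) →
         ValidEncoding enc k φ _≍_ ctx →
         (N : List Name) (a b : Name) → a ≢ b →
         ¬ (Σ (TCtx 1) λ T → (ctx (matchO a b) (a ∷ b ∷ N) ⟶* T) × Succ T)
lemma7 enc k φ _≍_ ctx V N a b _ C-succ =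
  outputs-silent N (reachesSucc⇒mentionsSucc source-succ)
  where
  source-succ : ReachesSucc (match _ a b (outputs N))
  source-succ = contextSucc⇒sourceSucc V (matchO a b) (a ∷ b ∷ N) (outputs N ∷ [])
                  (guardedOutputs-freeNames a b N) C-succ
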